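{- For $n \geq 3$, let $C_n$ be the cycle of length $n$. Then ${\rm ML}^{\rm W}(C_3)=3$ and ${\rm ML}^{\rm W}(C_n)=2n-6$ for every $n \geq 4$.
   Context: A walk of a graph $G$ is a sequence of vertices in which consecutive vertices are adjacent (repetitions allowed); its length is its number of traversed edges with repetition. For a walk $W$, $G+W$ is the multigraph on $V(G)$ with edge multiset $E(G)$ plus every edge traversed by $W$, added as many times as traversed. A multigraph is locally irregular if no two adjacent vertices have the same degree; $W$ is irregularising if $G+W$ is locally irregular. ${\rm ML}^{\rm W}(G)$ is the minimum length of an irregularising walk of $G$ (length $0$ allowed), $+\infty$ if none exists. -}

module Defs where

open import Data.Nat using (ℕ; zero; suc; _+_; _≤_; _%_; NonZero)
import Data.Nat as ℕ
open import Data.Fin using (Fin; toℕ; _≟_)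
open import Data.List using (List; []; _∷_; length; allFin; map)
open import Data.Nat.ListAction using (sum)
open import Data.List.Relation.Unary.Linked using (Linked)
open import Data.Product using (Σ; _×_; _,_)
open import Data.Sum using (_⊎_)
open import Relation.Nullary.Decidable using (_⊎-dec_)
open import Relation.Binary.PropositionalEquality using (_≡_; _≢_)
open import Relation.Nullary using (Dec; yes; no; ¬_)
open import Relation.Nullary.Decidable using (⌊_⌋)
open import Data.Bool using (if_then_else_)

-- A finite graph on vertex set Fin n, given by a decidable adjacency relation
-- (the only graphs used here are cycles, symmetric and loopless by construction).
record Graph (n : ℕ) : Set₁ where
  field
    Adj   : Fin n → Fin n → Set
    adj?  : ∀ u v → Dec (Adj u v)
open Graph public

indicator : {A : Set} → Dec A → ℕ
indicator (yes _) = 1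
indicator (no _)  = 0

degree : ∀ {n} → Graph n → Fin n → ℕ
degree {n} G v = sum (map (λ u → indicator (adj? G v u)) (allFin n))

record Walk {n : ℕ} (G : Graph n) : Set where
  constructor walk
  field
    start : Fin n
    rest  : List (Fin n)
    linked : Linked (Adj G) (start ∷ rest)
open Walk public

walkLength : ∀ {n} {G : Graph n} → Walk G → ℕ
walkLength W = length (rest W)

incidences : ∀ {n} → Fin n → List (Fin n) → ℕ
incidences v []            = 0
incidences v (a ∷ [])      = 0
incidences v (a ∷ b ∷ xs)  =
  indicator (a ≟ v) + indicator (b ≟ v) + incidences v (b ∷ xs)

-- degree of v in the multigraph G + W
degreePlus : ∀ {n} (G : Graph n) → Walk G → Fin n → ℕ
degreePlus G W v = degree G v + incidences v (start W ∷ rest W)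

-- G + W is locally irregular (adjacency in G + W equals adjacency in G,
-- since W only traverses edges of G)
Irregularising : ∀ {n} (G : Graph n) → Walk G → Set
Irregularising G W = ∀ u v → Adj G u v → degreePlus G W u ≢ degreePlus G W v

MLW≡ : ∀ {n} → Graph n → ℕ → Set
MLW≡ G m =
  Σ (Walk G) (λ W → Irregularising G W × walkLength W ≡ m)
  × (∀ (W : Walk G) → Irregularising G W → m ≤ walkLength W)

CycleAdj : (n : ℕ) → .{{NonZero n}} → Fin n → Fin n → Set
CycleAdj n i j = (toℕ j ≡ suc (toℕ i) % n) ⊎ (toℕ i ≡ suc (toℕ j) % n)

cycle : (n : ℕ) → .{{_ : NonZero n}} → Graph n
cycle n = record
  { Adj  = CycleAdj n
  ; adj? = λ i j → (toℕ j ℕ.≟ suc (toℕ i) % n) ⊎-dec (toℕ i ℕ.≟ suc (toℕ j) % n)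
  }

module Submission where

-- On a cycle every vertex has degree 2, so a walk is irregularising iff adjacent vertices are visited
-- different numbers of times. If M i counts the traversals of the edge {i, i+1}, vertex i+1 is visited
-- M i + M (i+1) times, so the condition is M i ≢ M (i+2) for all i.
-- Weigh each edge by M i, or by 2 if it is never traversed. The traversed edges form an arc, so two
-- untraversed edges are adjacent (otherwise the walk stays on one side of them and some e has
-- M e ≡ M (e+2) ≡ 0); hence the total weight is at most ℓ + 4 for a walk of length ℓ. On the other
-- hand M i ≢ M (i+2) makes the weights of the edges i and i+2 add up to at least 3, and to at least 4
-- when neither i+1 nor i+2 is an end of the walk, as M i, M (i+1), M (i+2) then have the same parity.
-- Summing over i gives 4n ≤ 2(ℓ + 4) + 4, that is ℓ ≥ 2n − 6.
-- Walks of length 2n − 6 climb a path with edge multiplicities 1,1,3,3,1,1,3,3,…, finished according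
-- to n mod 4. The triangle is settled by exhaustive evaluation.

open import Defs
open import Data.Empty using (⊥; ⊥-elim)
open import Data.Fin using (Fin; toℕ; fromℕ<; #_)
import Data.Fin as Fin
open import Data.Fin.Properties using (toℕ-injective; toℕ<n; toℕ-fromℕ<; all?)
open import Data.List using (List; []; _∷_; map; _++_; tabulate; allFin; length)
open import Data.List.Properties using (length-map; length-++; map-tabulate)
open import Data.List.Relation.Unary.All using (All; []; _∷_)
import Data.List.Relation.Unary.All as All
import Data.List.Relation.Unary.All.Properties as All
open import Data.List.Relation.Unary.Linked using (Linked; []; [-]; _∷_; linked?)
import Data.List.Relation.Unary.Linked as Linked
import Data.List.Relation.Unary.Linked.Properties as Linked
open import Data.Maybe.Relation.Binary.Connected using (just)
open import Data.Nat using (ℕ; zero; suc; _+_; _*_; _∸_; _≤_; _<_; z≤n; s≤s; NonZero; _%_; parity)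
open import Data.Nat.DivMod using (_/_; _mod_; m%n<n; m<n⇒m%n≡m; n%n≡0; m≡m%n+[m/n]*n)
open import Data.Nat.ListAction using (sum)
open import Data.Nat.Properties
open import Algebra.Properties.CommutativeSemigroup +-commutativeSemigroup using (interchange)
open import Data.Nat.Tactic.RingSolver using (solve-∀)
open import Data.Parity using (0ℙ; 1ℙ)
import Data.Parity as ℙ
open import Data.Parity.Properties using (p+p≡0ℙ; +-homo-+)
import Data.Parity.Properties as ℙ
open import Data.Product using (Σ; _×_; _,_)
open import Data.Sum using (_⊎_; inj₁; inj₂; [_,_]′; swap)
import Data.Sum as Sum
open import Function using (_∘_; id)
open import Function.Definitions using (Injective)
open import Relation.Binary.Definitions using (tri<; tri≈; tri>)
open import Relation.Binary.PropositionalEquality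
  using (_≡_; _≢_; refl; sym; trans; cong; cong₂; subst; module ≡-Reasoning)
open import Relation.Nullary using (¬_; Dec; yes; no; contradiction; ¬?)
open import Relation.Nullary.Decidable using (_⊎-dec_; _×-dec_; _→-dec_; from-yes)

indicator-yes : {A : Set} (a? : Dec A) → A → indicator a? ≡ 1
indicator-yes (yes _) _ = refl
indicator-yes (no ¬a) a = contradiction a ¬a

indicator-no : {A : Set} (a? : Dec A) → ¬ A → indicator a? ≡ 0
indicator-no (yes a) ¬a = contradiction a ¬a
indicator-no (no _)  _  = refl

indicator-cong : {A B : Set} (a? : Dec A) (b? : Dec B) → (A → B) → (B → A) →
                 indicator a? ≡ indicator b?
indicator-cong (yes _) (yes _) _ _ = refl
indicator-cong (yes a) (no ¬b) f _ = contradiction (f a) ¬b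
indicator-cong (no ¬a) (yes b) _ g = contradiction (g b) ¬a
indicator-cong (no _)  (no _)  _ _ = refl

indicator-⊎ : {A B : Set} (a? : Dec A) (b? : Dec B) → ¬ (A × B) →
              indicator (a? ⊎-dec b?) ≡ indicator a? + indicator b?
indicator-⊎ (yes a) (yes b) ¬ab = contradiction (a , b) ¬ab
indicator-⊎ (yes _) (no _)  _   = refl
indicator-⊎ (no _)  (yes _) _   = refl
indicator-⊎ (no _)  (no _)  _   = refl

≢-via : ∀ {A : Set} {a b c d : A} → a ≡ c → b ≡ d → c ≢ d → a ≢ b
≢-via a≡c b≡d c≢d a≡b = c≢d (trans (sym a≡c) (trans a≡b b≡d))

IrregularisingWalk : ∀ {n} → Graph n → ℕ → Set
IrregularisingWalk G ℓ = Σ (Walk G) λ W → Irregularising G W × walkLength W ≡ ℓ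

∑< : ℕ → (ℕ → ℕ) → ℕ
∑< zero    f = 0
∑< (suc n) f = ∑< n f + f n

syntax ∑< n (λ i → x) = ∑[ i < n ] x

∑-cong : ∀ n {f g : ℕ → ℕ} → (∀ {i} → i < n → f i ≡ g i) → ∑< n f ≡ ∑< n g
∑-cong zero    f≗g = refl
∑-cong (suc n) f≗g = cong₂ _+_ (∑-cong n (f≗g ∘ m<n⇒m<1+n)) (f≗g ≤-refl)

∑-mono-≤ : ∀ n {f g : ℕ → ℕ} → (∀ {i} → i < n → f i ≤ g i) → ∑< n f ≤ ∑< n g
∑-mono-≤ zero    f≤g = z≤n
∑-mono-≤ (suc n) f≤g = +-mono-≤ (∑-mono-≤ n (f≤g ∘ m<n⇒m<1+n)) (f≤g ≤-refl)

∑-distrib-+ : ∀ n (f g : ℕ → ℕ) → ∑[ i < n ] (f i + g i) ≡ ∑< n f + ∑< n g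
∑-distrib-+ zero    f g = refl
∑-distrib-+ (suc n) f g = begin
  ∑[ i < n ] (f i + g i) + (f n + g n)  ≡⟨ cong (_+ (f n + g n)) (∑-distrib-+ n f g) ⟩
  ∑< n f + ∑< n g + (f n + g n)         ≡⟨ interchange (∑< n f) (∑< n g) (f n) (g n) ⟩
  ∑< n f + f n + (∑< n g + g n)         ∎
  where open ≡-Reasoning

∑-*ˡ : ∀ n c (f : ℕ → ℕ) → ∑[ i < n ] (c * f i) ≡ c * ∑< n f
∑-*ˡ zero    c f = sym (*-zeroʳ c)
∑-*ˡ (suc n) c f = trans (cong (_+ c * f n) (∑-*ˡ n c f)) (sym (*-distribˡ-+ c (∑< n f) (f n)))

∑-const : ∀ n c → ∑[ i < n ] c ≡ n * c
∑-const zero    c = refl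
∑-const (suc n) c = trans (cong (_+ c) (∑-const n c)) (+-comm (n * c) c)

∑-zero : ∀ n {f : ℕ → ℕ} → (∀ {i} → i < n → f i ≡ 0) → ∑< n f ≡ 0
∑-zero n f≡0 = trans (∑-cong n f≡0) (trans (∑-const n 0) (*-zeroʳ n))

∑-sucˡ : ∀ n (f : ℕ → ℕ) → ∑< (suc n) f ≡ f 0 + ∑[ i < n ] f (suc i)
∑-sucˡ zero    f = +-comm 0 (f 0)
∑-sucˡ (suc n) f = trans (cong (_+ f (suc n)) (∑-sucˡ n f)) (+-assoc (f 0) _ _)

∑-indicator : ∀ {n c} → c < n → ∑[ i < n ] indicator (c ≟ i) ≡ 1
∑-indicator {suc n} {c} c<1+n with m≤n⇒m<n∨m≡n (≤-pred c<1+n)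
... | inj₁ c<n  = cong₂ _+_ (∑-indicator c<n) (indicator-no (c ≟ n) (<⇒≢ c<n))
... | inj₂ refl = cong₂ _+_ (∑-zero c λ i<c → indicator-no (c ≟ _) (>⇒≢ i<c)) (indicator-yes (c ≟ c) refl)

∑-indicator-⊆-pair : ∀ {n} {P : ℕ → Set} (P? : ∀ i → Dec (P i)) {e e′} → e < n → e′ < n →
                     (∀ {i} → i < n → P i → e ≡ i ⊎ e′ ≡ i) → ∑[ i < n ] indicator (P? i) ≤ 2
∑-indicator-⊆-pair {n} {P} P? {e} {e′} e<n e′<n P⊆ = begin
  ∑[ i < n ] indicator (P? i)
    ≤⟨ ∑-mono-≤ n (λ i<n → bound i<n (P? _)) ⟩
  ∑[ i < n ] (indicator (e ≟ i) + indicator (e′ ≟ i))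
    ≡⟨ ∑-distrib-+ n _ _ ⟩
  ∑[ i < n ] indicator (e ≟ i) + ∑[ i < n ] indicator (e′ ≟ i)
    ≡⟨ cong₂ _+_ (∑-indicator e<n) (∑-indicator e′<n) ⟩
  2
    ∎
  where
  open ≤-Reasoning
  bound : ∀ {i} → i < n → (p? : Dec (P i)) → indicator p? ≤ indicator (e ≟ i) + indicator (e′ ≟ i)
  bound i<n (no _)  = z≤n
  bound i<n (yes p) with P⊆ i<n p
  ... | inj₁ e≡i  = ≤-trans (≤-reflexive (sym (indicator-yes (e ≟ _) e≡i))) (m≤m+n _ _)
  ... | inj₂ e′≡i = ≤-trans (≤-reflexive (sym (indicator-yes (e′ ≟ _) e′≡i))) (m≤n+m _ _)

sum-tabulate-toℕ : ∀ n (g : ℕ → ℕ) → sum (tabulate {n = n} (g ∘ toℕ)) ≡ ∑< n g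
sum-tabulate-toℕ zero    g = refl
sum-tabulate-toℕ (suc n) g = trans (cong (g 0 +_) (sum-tabulate-toℕ n (g ∘ suc))) (sym (∑-sucˡ n g))

incidencesℕ : ℕ → List ℕ → ℕ
incidencesℕ i []           = 0
incidencesℕ i (a ∷ [])     = 0
incidencesℕ i (a ∷ b ∷ ws) = indicator (a ≟ i) + indicator (b ≟ i) + incidencesℕ i (b ∷ ws)

vertices : ∀ {n} {G : Graph n} → Walk G → List ℕ
vertices W = map toℕ (start W ∷ rest W)

incidences-toℕ : ∀ {n} (v : Fin n) ws → incidences v ws ≡ incidencesℕ (toℕ v) (map toℕ ws)
incidences-toℕ v []           = refl
incidences-toℕ v (a ∷ [])     = refl
incidences-toℕ v (a ∷ b ∷ ws) =
  cong₂ _+_ (cong₂ _+_ (indicator-toℕ a) (indicator-toℕ b)) (incidences-toℕ v (b ∷ ws))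
  where
  indicator-toℕ : ∀ u → indicator (u Fin.≟ v) ≡ indicator (toℕ u ≟ toℕ v)
  indicator-toℕ u = indicator-cong _ _ (cong toℕ) toℕ-injective

incidencesℕ-map-injective : ∀ {f : ℕ → ℕ} → Injective _≡_ _≡_ f → ∀ k ws →
                            incidencesℕ (f k) (map f ws) ≡ incidencesℕ k ws
incidencesℕ-map-injective         f-inj k []           = refl
incidencesℕ-map-injective         f-inj k (a ∷ [])     = refl
incidencesℕ-map-injective {f = f} f-inj k (a ∷ b ∷ ws) =
  cong₂ _+_ (cong₂ _+_ (indicator-f a) (indicator-f b)) (incidencesℕ-map-injective f-inj k (b ∷ ws))
  where
  indicator-f : ∀ x → indicator (f x ≟ f k) ≡ indicator (x ≟ k)
  indicator-f x = indicator-cong _ _ f-inj (cong f)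

incidencesℕ-map-outside : ∀ {f : ℕ → ℕ} {i} → (∀ x → f x ≢ i) → ∀ ws → incidencesℕ i (map f ws) ≡ 0
incidencesℕ-map-outside                 i∉f []           = refl
incidencesℕ-map-outside                 i∉f (a ∷ [])     = refl
incidencesℕ-map-outside {f = f} {i = i} i∉f (a ∷ b ∷ ws) =
  cong₂ _+_ (cong₂ _+_ (indicator-no (f a ≟ i) (i∉f a)) (indicator-no (f b ≟ i) (i∉f b)))
            (incidencesℕ-map-outside i∉f (b ∷ ws))

incidencesℕ-++ : ∀ i xs y ys →
                 incidencesℕ i (xs ++ y ∷ ys) ≡ incidencesℕ i (xs ++ y ∷ []) + incidencesℕ i (y ∷ ys)
incidencesℕ-++ i []            y ys = refl
incidencesℕ-++ i (x ∷ [])      y ys = cong (_+ incidencesℕ i (y ∷ ys)) (sym (+-identityʳ _))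
incidencesℕ-++ i (x ∷ x′ ∷ xs) y ys =
  trans (cong (indicator (x ≟ i) + indicator (x′ ≟ i) +_) (incidencesℕ-++ i (x′ ∷ xs) y ys))
        (sym (+-assoc (indicator (x ≟ i) + indicator (x′ ≟ i)) _ _))

lastVertex : ℕ → List ℕ → ℕ
lastVertex x []       = x
lastVertex x (y ∷ ys) = lastVertex y ys

lastVertex-All : ∀ {P : ℕ → Set} {x xs} → All P (x ∷ xs) → P (lastVertex x xs)
lastVertex-All {xs = []}    (px ∷ [])  = px
lastVertex-All {xs = _ ∷ _} (_ ∷ pxs) = lastVertex-All pxs

incidencesℕ-parity : ∀ i x xs → parity (incidencesℕ i (x ∷ xs)) ≡
                     parity (indicator (x ≟ i) + indicator (lastVertex x xs ≟ i))
incidencesℕ-parity i x [] = sym (trans (+-homo-+ X X) (p+p≡0ℙ (parity X)))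
  where X = indicator (x ≟ i)
incidencesℕ-parity i x (y ∷ ys) = begin
  parity (X + Y + incidencesℕ i (y ∷ ys))
    ≡⟨ +-homo-+ (X + Y) _ ⟩
  parity (X + Y) ℙ.+ parity (incidencesℕ i (y ∷ ys))
    ≡⟨ cong₂ ℙ._+_ (+-homo-+ X Y) (trans (incidencesℕ-parity i y ys) (+-homo-+ Y Z)) ⟩
  (parity X ℙ.+ parity Y) ℙ.+ (parity Y ℙ.+ parity Z)
    ≡⟨ cancel (parity X) (parity Y) (parity Z) ⟩
  parity X ℙ.+ parity Z
    ≡⟨ +-homo-+ X Z ⟨
  parity (X + Z)
    ∎
  where
  open ≡-Reasoning
  X = indicator (x ≟ i)
  Y = indicator (y ≟ i)
  Z = indicator (lastVertex y ys ≟ i)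
  cancel : ∀ p q r → (p ℙ.+ q) ℙ.+ (q ℙ.+ r) ≡ p ℙ.+ r
  cancel p q r = begin
    (p ℙ.+ q) ℙ.+ (q ℙ.+ r)  ≡⟨ ℙ.+-assoc p q (q ℙ.+ r) ⟩
    p ℙ.+ (q ℙ.+ (q ℙ.+ r))  ≡⟨ cong (p ℙ.+_) (ℙ.+-assoc q q r) ⟨
    p ℙ.+ ((q ℙ.+ q) ℙ.+ r)  ≡⟨ cong (λ t → p ℙ.+ (t ℙ.+ r)) (p+p≡0ℙ q) ⟩
    p ℙ.+ r                  ∎

parity-+≡0ℙ : ∀ a b → parity (a + b) ≡ 0ℙ → parity a ≡ parity b
parity-+≡0ℙ a b eq = ℙ.+-cancelʳ-≡ (parity b) (parity a) (parity b)
  (trans (sym (+-homo-+ a b)) (trans eq (sym (p+p≡0ℙ (parity b)))))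

Linked-propagate : ∀ {A : Set} {R : A → A → Set} {P : A → Set} → (∀ {a b} → R a b → P a → P b) →
                   ∀ {x xs} → Linked R (x ∷ xs) → P x → All P (x ∷ xs)
Linked-propagate R⇒P [-]         px = px ∷ []
Linked-propagate R⇒P (rxy ∷ rys) px = px ∷ Linked-propagate R⇒P rys (R⇒P rxy px)

weight : ℕ → ℕ
weight zero    = 2
weight (suc a) = suc a

weight≡ : ∀ a → weight a ≡ a + 2 * indicator (a ≟ 0)
weight≡ zero    = refl
weight≡ (suc a) = sym (+-identityʳ (suc a))

weight-≥1 : ∀ a → 1 ≤ weight a
weight-≥1 zero    = s≤s z≤n
weight-≥1 (suc a) = s≤s z≤n

weight-≥2 : ∀ {a} → a ≢ 1 → 2 ≤ weight a
weight-≥2 {zero}        _   = ≤-refl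
weight-≥2 {suc zero}    a≢1 = contradiction refl a≢1
weight-≥2 {suc (suc a)} _   = s≤s (s≤s z≤n)

weight-odd-≥3 : ∀ {a} → a ≢ 1 → parity a ≡ 1ℙ → 3 ≤ weight a
weight-odd-≥3 {suc zero}          a≢1 _ = contradiction refl a≢1
weight-odd-≥3 {suc (suc (suc a))} _   _ = s≤s (s≤s (s≤s z≤n))

weight-+-≥3 : ∀ {a b} → a ≢ b → 3 ≤ weight a + weight b
weight-+-≥3 {a} {b} a≢b with a ≟ 1 | b ≟ 1
... | yes refl | yes refl = contradiction refl a≢b
... | yes refl | no b≢1   = +-monoʳ-≤ 1 (weight-≥2 b≢1)
... | no a≢1   | _        = +-mono-≤ (weight-≥2 a≢1) (weight-≥1 b)

weight-+-≥4 : ∀ {a b} → a ≢ b → parity a ≡ parity b → 4 ≤ weight a + weight b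
weight-+-≥4 {a} {b} a≢b pa≡pb with a ≟ 1 | b ≟ 1
... | yes refl | yes refl = contradiction refl a≢b
... | yes refl | no b≢1   = +-monoʳ-≤ 1 (weight-odd-≥3 b≢1 (sym pa≡pb))
... | no a≢1   | yes refl = +-monoˡ-≤ 1 (weight-odd-≥3 a≢1 pa≡pb)
... | no a≢1   | no b≢1   = +-mono-≤ (weight-≥2 a≢1) (weight-≥2 b≢1)

4n≤2[ℓ+4]+4⇒2n∸6≤ℓ : ∀ {n ℓ} → n * 4 ≤ (ℓ + 4) + (ℓ + 4) + 4 → 2 * n ∸ 6 ≤ ℓ
4n≤2[ℓ+4]+4⇒2n∸6≤ℓ {n} {ℓ} bound = m≤n+o⇒m∸n≤o (2 * n) 6 (*-cancelˡ-≤ 2 (begin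
  2 * (2 * n)            ≡⟨ lhs n ⟩
  n * 4                  ≤⟨ bound ⟩
  (ℓ + 4) + (ℓ + 4) + 4  ≡⟨ rhs ℓ ⟩
  2 * (6 + ℓ)            ∎))
  where
  open ≤-Reasoning
  lhs : ∀ n → 2 * (2 * n) ≡ n * 4
  lhs = solve-∀
  rhs : ∀ ℓ → (ℓ + 4) + (ℓ + 4) + 4 ≡ 2 * (6 + ℓ)
  rhs = solve-∀

-- The cycle on suc m vertices, in ℕ coordinates

Consecutive : ℕ → ℕ → Set
Consecutive a b = b ≡ suc a ⊎ a ≡ suc b

consecutive? : ∀ a b → Dec (Consecutive a b)
consecutive? a b = (b ≟ suc a) ⊎-dec (a ≟ suc b)

module Cycle (m : ℕ) where

  n : ℕ
  n = suc m

  next : ℕ → ℕ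
  next x = suc x % n

  next² : ℕ → ℕ
  next² = next ∘ next

  prev : ℕ → ℕ
  prev zero    = m
  prev (suc x) = x

  Adjacent : ℕ → ℕ → Set
  Adjacent a b = b ≡ next a ⊎ a ≡ next b

  next-< : ∀ x → next x < n
  next-< x = m%n<n (suc x) n

  next-inner : ∀ {x} → suc x < n → next x ≡ suc x
  next-inner = m<n⇒m%n≡m

  next-last : next m ≡ 0
  next-last = n%n≡0 n

  next-cases : ∀ {x} → x < n → (suc x < n × next x ≡ suc x) ⊎ (x ≡ m × next x ≡ 0)
  next-cases (s≤s x≤m) with m≤n⇒m<n∨m≡n x≤m
  ... | inj₁ x<m  = inj₁ (s≤s x<m , next-inner (s≤s x<m))
  ... | inj₂ refl = inj₂ (refl , next-last)

  next-injective : ∀ {a b} → a < n → b < n → next a ≡ next b → a ≡ b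
  next-injective a<n b<n eq with next-cases a<n | next-cases b<n
  ... | inj₁ (_ , p) | inj₁ (_ , q) = suc-injective (trans (sym p) (trans eq q))
  ... | inj₁ (_ , p) | inj₂ (_ , q) = contradiction (trans (sym p) (trans eq q)) λ ()
  ... | inj₂ (_ , p) | inj₁ (_ , q) = contradiction (trans (sym q) (trans (sym eq) p)) λ ()
  ... | inj₂ (p , _) | inj₂ (q , _) = trans p (sym q)

  prev-< : ∀ {e} → e < n → prev e < n
  prev-< {zero}  _     = ≤-refl
  prev-< {suc e} e+1<n = <-trans (n<1+n e) e+1<n

  next-prev : ∀ {e} → e < n → next (prev e) ≡ e
  next-prev {zero}  _     = next-last
  next-prev {suc e} e+1<n = next-inner e+1<n

  next²≢id : 2 ≤ m → ∀ {a} → a < n → next² a ≢ a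
  next²≢id m≥2 a<n with next-cases a<n
  ... | inj₂ (refl , p) = λ eq → <⇒≢ m≥2 (trans (sym (trans (cong next p) (next-inner (m≤n⇒m≤1+n m≥2)))) eq)
  ... | inj₁ (a+1<n , p) with next-cases a+1<n
  ...   | inj₁ (_ , q)     = λ eq → <⇒≢ (m<n⇒m<1+n (n<1+n _)) (sym (trans (sym (trans (cong next p) q)) eq))
  ...   | inj₂ (a+1≡m , q) = λ eq → <⇒≢ m≥2 (trans (cong suc (trans (sym (trans (cong next p) q)) eq)) a+1≡m)

  ∑-next : ∀ (f : ℕ → ℕ) → ∑[ i < n ] f (next i) ≡ ∑< n f
  ∑-next f = begin
    ∑[ i < m ] f (next i) + f (next m)  ≡⟨ cong₂ _+_ (∑-cong m (cong f ∘ next-inner ∘ s≤s)) (cong f next-last) ⟩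
    ∑[ i < m ] f (suc i) + f 0          ≡⟨ +-comm _ (f 0) ⟩
    f 0 + ∑[ i < m ] f (suc i)          ≡⟨ ∑-sucˡ m f ⟨
    ∑< n f                              ∎
    where open ≡-Reasoning

  ∑-next² : ∀ (f : ℕ → ℕ) → ∑[ i < n ] f (next² i) ≡ ∑< n f
  ∑-next² f = trans (∑-next (f ∘ next)) (∑-next f)

  degree-cycle : 2 ≤ m → (v : Fin n) → degree (cycle n) v ≡ 2
  degree-cycle m≥2 v = begin
    sum (map (λ u → indicator (adj? (cycle n) v u)) (allFin n))
      ≡⟨ cong sum (map-tabulate id (λ u → indicator (adj? (cycle n) v u))) ⟩
    sum (tabulate (λ u → indicator (adj? (cycle n) v u)))
      ≡⟨ sum-tabulate-toℕ n _ ⟩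
    ∑[ k < n ] indicator ((k ≟ next x) ⊎-dec (x ≟ next k))
      ≡⟨ ∑-cong n (λ {k} _ → indicator-⊎ (k ≟ next x) (x ≟ next k) λ (k≡ , x≡) →
                              next²≢id m≥2 x<n (trans (cong next (sym k≡)) (sym x≡))) ⟩
    ∑[ k < n ] (indicator (k ≟ next x) + indicator (x ≟ next k))
      ≡⟨ ∑-distrib-+ n _ _ ⟩
    ∑[ k < n ] indicator (k ≟ next x) + ∑[ k < n ] indicator (x ≟ next k)
      ≡⟨ cong₂ _+_ (∑-cong n λ {k} _ → indicator-cong (k ≟ next x) (next x ≟ k) sym sym)
                   (∑-cong n λ {k} k<n → indicator-cong (x ≟ next k) (prev x ≟ k) (prev≡ k<n) (≡next k<n)) ⟩
    ∑[ k < n ] indicator (next x ≟ k) + ∑[ k < n ] indicator (prev x ≟ k)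
      ≡⟨ cong₂ _+_ (∑-indicator (next-< x)) (∑-indicator (prev-< x<n)) ⟩
    2 ∎
    where
    open ≡-Reasoning
    x = toℕ v
    x<n = toℕ<n v
    prev≡ : ∀ {k} → k < n → x ≡ next k → prev x ≡ k
    prev≡ k<n x≡ = next-injective (prev-< x<n) k<n (trans (next-prev x<n) x≡)
    ≡next : ∀ {k} → k < n → prev x ≡ k → x ≡ next k
    ≡next _ refl = sym (next-prev x<n)

  Irregularℕ : List ℕ → Set
  Irregularℕ ws = ∀ {i} → i < n → incidencesℕ i ws ≢ incidencesℕ (next i) ws

  path-alternating⇒irregularℕ : ∀ {ws} → (∀ {k} → k < m → incidencesℕ k ws ≢ incidencesℕ (suc k) ws) →
                                incidencesℕ m ws ≢ incidencesℕ 0 ws → Irregularℕ ws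
  path-alternating⇒irregularℕ {ws} inner outer i<n with next-cases i<n
  ... | inj₁ (s≤s i<m , p) = λ eq → inner i<m (trans eq (cong (λ k → incidencesℕ k ws) p))
  ... | inj₂ (refl , p)    = λ eq → outer (trans eq (cong (λ k → incidencesℕ k ws) p))

  module _ (m≥2 : 2 ≤ m) (W : Walk (cycle n)) where

    private
      T : ℕ → ℕ
      T k = incidencesℕ k (vertices W)

    degreePlus-cycle : (v : Fin n) → degreePlus (cycle n) W v ≡ 2 + T (toℕ v)
    degreePlus-cycle v = cong₂ _+_ (degree-cycle m≥2 v) (incidences-toℕ v (start W ∷ rest W))

    degreePlus≡⇒incidences≡ : ∀ u v → degreePlus (cycle n) W u ≡ degreePlus (cycle n) W v →
                              T (toℕ u) ≡ T (toℕ v)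
    degreePlus≡⇒incidences≡ u v eq =
      +-cancelˡ-≡ 2 _ _ (trans (sym (degreePlus-cycle u)) (trans eq (degreePlus-cycle v)))

    irregularising⇒irregularℕ : Irregularising (cycle n) W → Irregularℕ (vertices W)
    irregularising⇒irregularℕ irr {i} i<n Ti≡Tnext = irr u v (inj₁ adjacent) (begin
      degreePlus (cycle n) W u  ≡⟨ degreePlus-cycle u ⟩
      2 + T (toℕ u)             ≡⟨ cong (λ k → 2 + T k) (toℕ-fromℕ< i<n) ⟩
      2 + T i                   ≡⟨ cong (2 +_) Ti≡Tnext ⟩
      2 + T (next i)            ≡⟨ cong (λ k → 2 + T k) (toℕ-fromℕ< (next-< i)) ⟨
      2 + T (toℕ v)             ≡⟨ degreePlus-cycle v ⟨
      degreePlus (cycle n) W v  ∎)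
      where
      open ≡-Reasoning
      u = fromℕ< i<n
      v = fromℕ< (next-< i)
      adjacent : toℕ v ≡ next (toℕ u)
      adjacent = trans (toℕ-fromℕ< (next-< i)) (cong next (sym (toℕ-fromℕ< i<n)))

    irregularℕ⇒irregularising : Irregularℕ (vertices W) → Irregularising (cycle n) W
    irregularℕ⇒irregularising irr u v (inj₁ v≡) eq =
      irr (toℕ<n u) (trans (degreePlus≡⇒incidences≡ u v eq) (cong T v≡))
    irregularℕ⇒irregularising irr u v (inj₂ u≡) eq =
      irr (toℕ<n v) (trans (degreePlus≡⇒incidences≡ v u (sym eq)) (cong T u≡))

  map-toℕ-mod : ∀ {ws} → All (_< n) ws → map toℕ (map (_mod n) ws) ≡ ws
  map-toℕ-mod []              = refl
  map-toℕ-mod (x<n ∷ bounded) = cong₂ _∷_ (trans (toℕ-fromℕ< _) (m<n⇒m%n≡m x<n)) (map-toℕ-mod bounded)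

  walkℕ : ∀ {x xs} → All (_< n) (x ∷ xs) → Linked Adjacent (x ∷ xs) → Walk (cycle n)
  walkℕ {x} {xs} bounded adjacent =
    walk (x mod n) (map (_mod n) xs)
         (Linked.map⁻ (subst (Linked Adjacent) (sym (map-toℕ-mod bounded)) adjacent))

  irregularℕ⇒walk : 2 ≤ m → ∀ {x xs} → All (_< n) (x ∷ xs) → Linked Adjacent (x ∷ xs) →
                    Irregularℕ (x ∷ xs) → IrregularisingWalk (cycle n) (length xs)
  irregularℕ⇒walk m≥2 {xs = xs} bounded adjacent irr =
    W , irregularℕ⇒irregularising m≥2 W (subst Irregularℕ (sym (map-toℕ-mod bounded)) irr) , length-map _ xs
    where W = walkℕ bounded adjacent

  Linked-consecutive⇒adjacent : ∀ {ws} → All (_< n) ws → Linked Consecutive ws → Linked Adjacent ws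
  Linked-consecutive⇒adjacent []                        []              = []
  Linked-consecutive⇒adjacent (_ ∷ [])                  [-]             = [-]
  Linked-consecutive⇒adjacent (a<n ∷ bounded@(b<n ∷ _)) (step ∷ linked) =
    Sum.map (λ b≡ → trans b≡ (sym (next-inner (subst (_< n) b≡ b<n))))
            (λ a≡ → trans a≡ (sym (next-inner (subst (_< n) a≡ a<n)))) step
    ∷ Linked-consecutive⇒adjacent bounded linked

  -- Edge g joins g and next g; edge a b is the edge used by a step from a to b.

  Joins : ℕ → ℕ → ℕ → Set
  Joins g a b = (a ≡ g × b ≡ next g) ⊎ (b ≡ g × a ≡ next g)

  edge : ℕ → ℕ → ℕ
  edge a b with b ≟ next a
  ... | yes _ = a
  ... | no  _ = b

  edge-∈ : ∀ a b → edge a b ≡ a ⊎ edge a b ≡ b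
  edge-∈ a b with b ≟ next a
  ... | yes _ = inj₁ refl
  ... | no  _ = inj₂ refl

  edge-joins : ∀ {a b} → Adjacent a b → Joins (edge a b) a b
  edge-joins {a} {b} adj with b ≟ next a
  ... | yes b≡ = inj₁ (refl , b≡)
  ... | no  b≢ = inj₂ (refl , [ (λ b≡ → contradiction b≡ b≢) , id ]′ adj)

  edge-< : ∀ {a b} → a < n → b < n → edge a b < n
  edge-< {a} {b} a<n b<n =
    [ (λ e≡a → subst (_< n) (sym e≡a) a<n) , (λ e≡b → subst (_< n) (sym e≡b) b<n) ]′ (edge-∈ a b)

  multiplicity : ℕ → List ℕ → ℕ
  multiplicity e []           = 0
  multiplicity e (a ∷ [])     = 0
  multiplicity e (a ∷ b ∷ ws) = indicator (edge a b ≟ e) + multiplicity e (b ∷ ws)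

  ∑-multiplicity : ∀ {x xs} → All (_< n) (x ∷ xs) → ∑[ e < n ] multiplicity e (x ∷ xs) ≡ length xs
  ∑-multiplicity {xs = []}     _                         = ∑-zero n (λ _ → refl)
  ∑-multiplicity {x} {y ∷ xs} (x<n ∷ bounded@(y<n ∷ _)) = begin
    ∑[ e < n ] (indicator (edge x y ≟ e) + multiplicity e (y ∷ xs))
      ≡⟨ ∑-distrib-+ n _ _ ⟩
    ∑[ e < n ] indicator (edge x y ≟ e) + ∑[ e < n ] multiplicity e (y ∷ xs)
      ≡⟨ cong₂ _+_ (∑-indicator (edge-< x<n y<n)) (∑-multiplicity bounded) ⟩
    1 + length xs
      ∎
    where open ≡-Reasoning

  next-indicator : ∀ {g i} → g < n → i < n → indicator (next g ≟ next i) ≡ indicator (g ≟ i)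
  next-indicator {g} {i} g<n i<n = indicator-cong (next g ≟ next i) (g ≟ i) (next-injective g<n i<n) (cong next)

  incidences-step : ∀ {g a b i} → g < n → i < n → Joins g a b →
                    indicator (a ≟ next i) + indicator (b ≟ next i) ≡ indicator (g ≟ i) + indicator (g ≟ next i)
  incidences-step {g} {i = i} g<n i<n (inj₁ (refl , refl)) =
    trans (+-comm (indicator (g ≟ next i)) (indicator (next g ≟ next i)))
          (cong (_+ indicator (g ≟ next i)) (next-indicator g<n i<n))
  incidences-step {g} {i = i} g<n i<n (inj₂ (refl , refl)) =
    cong (_+ indicator (g ≟ next i)) (next-indicator g<n i<n)

  incidences-multiplicity : ∀ {ws i} → All (_< n) ws → Linked Adjacent ws → i < n →
                            incidencesℕ (next i) ws ≡ multiplicity i ws + multiplicity (next i) ws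
  incidences-multiplicity []       []  _ = refl
  incidences-multiplicity (_ ∷ []) [-] _ = refl
  incidences-multiplicity {a ∷ b ∷ ws} {i} (a<n ∷ bounded@(b<n ∷ _)) (adj ∷ adjacent) i<n = begin
    indicator (a ≟ next i) + indicator (b ≟ next i) + incidencesℕ (next i) (b ∷ ws)
      ≡⟨ cong₂ _+_ (incidences-step (edge-< a<n b<n) i<n (edge-joins adj))
                   (incidences-multiplicity bounded adjacent i<n) ⟩
    indicator (edge a b ≟ i) + indicator (edge a b ≟ next i)
      + (multiplicity i (b ∷ ws) + multiplicity (next i) (b ∷ ws))
      ≡⟨ interchange (indicator (edge a b ≟ i)) (indicator (edge a b ≟ next i)) _ _ ⟩
    multiplicity i (a ∷ b ∷ ws) + multiplicity (next i) (a ∷ b ∷ ws)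
      ∎
    where open ≡-Reasoning

  multiplicity-unvisited : ∀ {P : ℕ → Set} {g ws} → All P ws → ¬ P g → multiplicity g ws ≡ 0
  multiplicity-unvisited []       _ = refl
  multiplicity-unvisited (_ ∷ []) _ = refl
  multiplicity-unvisited {P} {g} {a ∷ b ∷ _} (pa ∷ visited@(pb ∷ _)) ¬pg =
    cong₂ _+_ (indicator-no (edge a b ≟ g) edge≢g) (multiplicity-unvisited visited ¬pg)
    where
    edge≢g : edge a b ≢ g
    edge≢g e≡g = ¬pg (subst P e≡g
      ([ (λ e≡a → subst P (sym e≡a) pa) , (λ e≡b → subst P (sym e≡b) pb) ]′ (edge-∈ a b)))

  Avoids : ℕ → ℕ → ℕ → ℕ → Set
  Avoids e f a b = Σ ℕ λ g → g < n × g ≢ e × g ≢ f × Joins g a b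

  Linked-avoids : ∀ {e f ws} → All (_< n) ws → Linked Adjacent ws →
                  multiplicity e ws ≡ 0 → multiplicity f ws ≡ 0 → Linked (Avoids e f) ws
  Linked-avoids []       []  _ _ = []
  Linked-avoids (_ ∷ []) [-] _ _ = [-]
  Linked-avoids {e} {f} {a ∷ b ∷ _} (a<n ∷ bounded@(b<n ∷ _)) (adj ∷ adjacent) Me≡0 Mf≡0 =
    (edge a b , edge-< a<n b<n , ≢-of Me≡0 , ≢-of Mf≡0 , edge-joins adj)
    ∷ Linked-avoids bounded adjacent (m+n≡0⇒n≡0 _ Me≡0) (m+n≡0⇒n≡0 _ Mf≡0)
    where
    ≢-of : ∀ {h} → indicator (edge a b ≟ h) + _ ≡ 0 → edge a b ≢ h
    ≢-of {h} M≡0 eq = contradiction (trans (sym (indicator-yes (edge a b ≟ h) eq)) (m+n≡0⇒m≡0 _ M≡0)) λ ()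

  -- Deleting the edges e < f splits the cycle into Arc e f and its complement.

  Arc : ℕ → ℕ → ℕ → Set
  Arc e f y = e < y × y ≤ f

  module _ {e f} (e<f : e < f) (f<n : f < n) where

    arc-next : ∀ {g} → g ≢ f → Arc e f g → Arc e f (next g)
    arc-next {g} g≢f (e<g , g≤f) = subst (Arc e f) (sym (next-inner (≤-<-trans g<f f<n))) (m<n⇒m<1+n e<g , g<f)
      where g<f = ≤∧≢⇒< g≤f g≢f

    arc-next⁻ : ∀ {g} → g < n → g ≢ e → Arc e f (next g) → Arc e f g
    arc-next⁻ g<n g≢e arc with next-cases g<n
    ... | inj₁ (_ , p) with e<g+1 , g+1≤f ← subst (Arc e f) p arc = ≤∧≢⇒< (≤-pred e<g+1) (g≢e ∘ sym) , <⇒≤ g+1≤f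
    ... | inj₂ (_ , p) with () , _ ← subst (Arc e f) p arc

    avoids-arc : ∀ {a b} → Avoids e f a b → Arc e f a → Arc e f b
    avoids-arc (g , g<n , g≢e , g≢f , inj₁ (refl , refl)) = arc-next g≢f
    avoids-arc (g , g<n , g≢e , g≢f , inj₂ (refl , refl)) = arc-next⁻ g<n g≢e

    avoids-¬arc : ∀ {a b} → Avoids e f a b → ¬ Arc e f a → ¬ Arc e f b
    avoids-¬arc (g , g<n , g≢e , g≢f , inj₁ (refl , refl)) ¬arc = ¬arc ∘ arc-next⁻ g<n g≢e
    avoids-¬arc (g , g<n , g≢e , g≢f , inj₂ (refl , refl)) ¬arc = ¬arc ∘ arc-next g≢f

    confined : ∀ {x xs} → All (_< n) (x ∷ xs) → Linked Adjacent (x ∷ xs) →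
               multiplicity e (x ∷ xs) ≡ 0 → multiplicity f (x ∷ xs) ≡ 0 →
               All (Arc e f) (x ∷ xs) ⊎ All (¬_ ∘ Arc e f) (x ∷ xs)
    confined {x} bounded adjacent Me≡0 Mf≡0 with (e <? x) ×-dec (x ≤? f)
    ... | yes arc = inj₁ (Linked-propagate avoids-arc (Linked-avoids bounded adjacent Me≡0 Mf≡0) arc)
    ... | no ¬arc = inj₂ (Linked-propagate avoids-¬arc (Linked-avoids bounded adjacent Me≡0 Mf≡0) ¬arc)

    next²-beyond : ¬ (e ≡ 0 × f ≡ m) → ¬ Arc e f (next² f)
    next²-beyond ¬wrap with next-cases f<n
    ... | inj₂ (refl , p) = λ (e<1 , _) → ¬wrap (n<1⇒n≡0 (subst (e <_) next²m≡1 e<1) , refl)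
      where next²m≡1 = trans (cong next p) (next-inner (s≤s (≤-trans (s≤s z≤n) e<f)))
    ... | inj₁ (f+1<n , p) with next-cases f+1<n
    ...   | inj₁ (_ , q) = λ (_ , f+2≤f) → 1+n≰n (≤-trans (n≤1+n _) (subst (_≤ f) (trans (cong next p) q) f+2≤f))
    ...   | inj₂ (_ , q) = λ (e<0 , _) → n≮0 (subst (e <_) (trans (cong next p) q) e<0)

    next²-between : suc e ≢ f → Arc e f (next² e)
    next²-between e+1≢f = subst (Arc e f) (sym next²e≡) (m<n⇒m<1+n (n<1+n e) , e+2≤f)
      where
      e+2≤f : suc (suc e) ≤ f
      e+2≤f = ≤∧≢⇒< e<f e+1≢f
      next²e≡ : next² e ≡ suc (suc e)
      next²e≡ = trans (cong next (next-inner (<-trans e+2≤f f<n))) (next-inner (≤-<-trans e+2≤f f<n))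

  module LowerBound {x xs} (bounded : All (_< n) (x ∷ xs)) (adjacent : Linked Adjacent (x ∷ xs))
                    (irregular : Irregularℕ (x ∷ xs)) where

    M : ℕ → ℕ
    M e = multiplicity e (x ∷ xs)

    M-skip : ∀ {i} → i < n → M i ≢ M (next² i)
    M-skip {i} i<n Mi≡M = irregular (next-< i) (begin
      incidencesℕ (next i) (x ∷ xs)   ≡⟨ incidences-multiplicity bounded adjacent i<n ⟩
      M i + M (next i)                ≡⟨ cong (_+ M (next i)) Mi≡M ⟩
      M (next² i) + M (next i)        ≡⟨ +-comm (M (next² i)) (M (next i)) ⟩
      M (next i) + M (next² i)        ≡⟨ incidences-multiplicity bounded adjacent (next-< i) ⟨
      incidencesℕ (next² i) (x ∷ xs)  ∎)
      where open ≡-Reasoning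

    separated-zero-edges : ∀ {e f} → e < f → f < n → suc e ≢ f → ¬ (e ≡ 0 × f ≡ m) →
                           M e ≡ 0 → M f ≡ 0 → ⊥
    separated-zero-edges e<f f<n e+1≢f ¬wrap Me≡0 Mf≡0 with confined e<f f<n bounded adjacent Me≡0 Mf≡0
    ... | inj₁ inside  = M-skip f<n
      (trans Mf≡0 (sym (multiplicity-unvisited inside (next²-beyond e<f f<n ¬wrap))))
    ... | inj₂ outside = M-skip (<-trans e<f f<n)
      (trans Me≡0 (sym (multiplicity-unvisited outside (λ ¬arc → ¬arc (next²-between e<f f<n e+1≢f)))))

    zero-edges-adjacent< : ∀ {e f} → e < f → f < n → M e ≡ 0 → M f ≡ 0 → Adjacent e f
    zero-edges-adjacent< {e} {f} e<f f<n Me≡0 Mf≡0 with suc e ≟ f | (e ≟ 0) ×-dec (f ≟ m)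
    ... | yes refl | _                 = inj₁ (sym (next-inner f<n))
    ... | no _     | yes (refl , refl) = inj₂ (sym next-last)
    ... | no e+1≢f | no ¬wrap          = ⊥-elim (separated-zero-edges e<f f<n e+1≢f ¬wrap Me≡0 Mf≡0)

    zero-edges-adjacent : ∀ {a b} → a < n → b < n → M a ≡ 0 → M b ≡ 0 → a ≡ b ⊎ Adjacent a b
    zero-edges-adjacent {a} {b} a<n b<n Ma≡0 Mb≡0 with <-cmp a b
    ... | tri< a<b _ _ = inj₂ (zero-edges-adjacent< a<b b<n Ma≡0 Mb≡0)
    ... | tri≈ _ a≡b _ = inj₁ a≡b
    ... | tri> _ _ b<a = inj₂ (swap (zero-edges-adjacent< b<a a<n Mb≡0 Ma≡0))

    #zero-edges : ℕ
    #zero-edges = ∑[ i < n ] indicator (M i ≟ 0)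

    #zero-edges≤2 : #zero-edges ≤ 2
    #zero-edges≤2 with anyUpTo? (λ i → M i ≟ 0) n
    ... | no none = ≤-trans (≤-reflexive no-zeros) z≤n
      where no-zeros = ∑-zero n λ {i} i<n → indicator-no (M i ≟ 0) (λ Mi≡0 → none (i , i<n , Mi≡0))
    ... | yes (e , e<n , Me≡0) with M (next e) ≟ 0
    ...   | yes Mnext≡0 = ∑-indicator-⊆-pair (λ i → M i ≟ 0) e<n (next-< e) zeros⊆
      where
      zeros⊆ : ∀ {i} → i < n → M i ≡ 0 → e ≡ i ⊎ next e ≡ i
      zeros⊆ i<n Mi≡0 with zero-edges-adjacent e<n i<n Me≡0 Mi≡0
      ... | inj₁ e≡i         = inj₁ e≡i
      ... | inj₂ (inj₁ i≡)   = inj₂ (sym i≡)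
      ... | inj₂ (inj₂ refl) = contradiction (trans Mi≡0 (sym Mnext≡0)) (M-skip i<n)
    ...   | no Mnext≢0 = ∑-indicator-⊆-pair (λ i → M i ≟ 0) e<n (prev-< e<n) zeros⊆
      where
      zeros⊆ : ∀ {i} → i < n → M i ≡ 0 → e ≡ i ⊎ prev e ≡ i
      zeros⊆ i<n Mi≡0 with zero-edges-adjacent e<n i<n Me≡0 Mi≡0
      ... | inj₁ e≡i         = inj₁ e≡i
      ... | inj₂ (inj₁ refl) = contradiction Mi≡0 Mnext≢0
      ... | inj₂ (inj₂ e≡)   = inj₂ (next-injective (prev-< e<n) i<n (trans (next-prev e<n) e≡))

    ∑-weight : ∑[ i < n ] weight (M i) ≤ length xs + 4
    ∑-weight = begin
      ∑[ i < n ] weight (M i)                        ≡⟨ ∑-cong n (λ {i} _ → weight≡ (M i)) ⟩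
      ∑[ i < n ] (M i + 2 * indicator (M i ≟ 0))     ≡⟨ ∑-distrib-+ n _ _ ⟩
      ∑< n M + ∑[ i < n ] (2 * indicator (M i ≟ 0))  ≡⟨ cong₂ _+_ (∑-multiplicity bounded) (∑-*ˡ n 2 _) ⟩
      length xs + 2 * #zero-edges                    ≤⟨ +-monoʳ-≤ (length xs) (*-monoʳ-≤ 2 #zero-edges≤2) ⟩
      length xs + 4                                  ∎
      where open ≤-Reasoning

    endpoints : ℕ → ℕ
    endpoints j = indicator (x ≟ j) + indicator (lastVertex x xs ≟ j)

    ∑-endpoints : ∑< n endpoints ≡ 2
    ∑-endpoints = trans (∑-distrib-+ n _ _)
                        (cong₂ _+_ (∑-indicator (All.head bounded)) (∑-indicator (lastVertex-All bounded)))

    M-parity : ∀ {i} → i < n → endpoints (next i) ≡ 0 → parity (M i) ≡ parity (M (next i))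
    M-parity {i} i<n no-endpoint = parity-+≡0ℙ (M i) (M (next i)) (begin
      parity (M i + M (next i))              ≡⟨ cong parity (incidences-multiplicity bounded adjacent i<n) ⟨
      parity (incidencesℕ (next i) (x ∷ xs)) ≡⟨ incidencesℕ-parity (next i) x xs ⟩
      parity (endpoints (next i))            ≡⟨ cong parity no-endpoint ⟩
      0ℙ                                     ∎)
      where open ≡-Reasoning

    charge : ℕ → ℕ
    charge i = weight (M i) + weight (M (next² i)) + (endpoints (next i) + endpoints (next² i))

    charge-≥4 : ∀ {i} → i < n → 4 ≤ charge i
    charge-≥4 {i} i<n with endpoints (next i) + endpoints (next² i) ≟ 0
    ... | yes none = ≤-trans (weight-+-≥4 (M-skip i<n) same-parity)
                             (m≤m+n _ (endpoints (next i) + endpoints (next² i)))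
      where
      same-parity = trans (M-parity i<n (m+n≡0⇒m≡0 (endpoints (next i)) none))
                          (M-parity (next-< i) (m+n≡0⇒n≡0 (endpoints (next i)) none))
    ... | no some  = +-mono-≤ (weight-+-≥3 (M-skip i<n)) (n≢0⇒n>0 some)

    ∑-charge : ∑< n charge ≡ ∑[ i < n ] weight (M i) + ∑[ i < n ] weight (M i) + 4
    ∑-charge = begin
      ∑< n charge
        ≡⟨ ∑-distrib-+ n (λ i → weight (M i) + weight (M (next² i)))
                         (λ i → endpoints (next i) + endpoints (next² i)) ⟩
      ∑[ i < n ] (weight (M i) + weight (M (next² i))) + ∑[ i < n ] (endpoints (next i) + endpoints (next² i))
        ≡⟨ cong₂ _+_ (∑-distrib-+ n (weight ∘ M) (weight ∘ M ∘ next²))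
                     (∑-distrib-+ n (endpoints ∘ next) (endpoints ∘ next²)) ⟩
      W + ∑[ i < n ] weight (M (next² i)) + (∑[ i < n ] endpoints (next i) + ∑[ i < n ] endpoints (next² i))
        ≡⟨ cong₂ _+_ (cong (W +_) (∑-next² (weight ∘ M)))
                     (cong₂ _+_ (trans (∑-next endpoints) ∑-endpoints)
                                (trans (∑-next² endpoints) ∑-endpoints)) ⟩
      W + W + 4
        ∎
      where
      open ≡-Reasoning
      W = ∑[ i < n ] weight (M i)

    length-bound : 2 * n ∸ 6 ≤ length xs
    length-bound = 4n≤2[ℓ+4]+4⇒2n∸6≤ℓ {n} {length xs} (begin
      n * 4                                          ≡⟨ ∑-const n 4 ⟨
      ∑[ i < n ] 4                                   ≤⟨ ∑-mono-≤ n charge-≥4 ⟩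
      ∑< n charge                                    ≡⟨ ∑-charge ⟩
      ∑< n (weight ∘ M) + ∑< n (weight ∘ M) + 4      ≤⟨ +-monoˡ-≤ 4 (+-mono-≤ ∑-weight ∑-weight) ⟩
      (length xs + 4) + (length xs + 4) + 4          ∎)
      where open ≤-Reasoning

  lower-bound : 2 ≤ m → (W : Walk (cycle n)) → Irregularising (cycle n) W → 2 * n ∸ 6 ≤ walkLength W
  lower-bound m≥2 W irr = subst (2 * n ∸ 6 ≤_) (length-map toℕ (rest W)) (LowerBound.length-bound
    (All.map⁺ (All.universal toℕ<n (start W ∷ rest W)))
    (Linked.map⁺ (Walk.linked W))
    (irregularising⇒irregularℕ m≥2 W irr))

-- Irregularising walks of length 2n − 6

block : List ℕ
block = 1 ∷ 2 ∷ 3 ∷ 4 ∷ 3 ∷ 2 ∷ 3 ∷ []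

finish : Fin 3 → List ℕ
finish Fin.zero                     = 1 ∷ 2 ∷ []
finish (Fin.suc Fin.zero)           = 1 ∷ 2 ∷ 3 ∷ 2 ∷ []
finish (Fin.suc (Fin.suc Fin.zero)) = 1 ∷ 2 ∷ 3 ∷ 4 ∷ 3 ∷ 2 ∷ []

-- The walk 0 ∷ ascent j r traverses the edges {k, k+1} with k + 1 < top j r, with multiplicities
-- (1,1,3,3)ʲ followed by 1,1 / 1,1,2 / 1,1,2,2 according to r.

ascent : ℕ → Fin 3 → List ℕ
ascent zero    r = finish r
ascent (suc j) r = block ++ map (4 +_) (0 ∷ ascent j r)

top : ℕ → Fin 3 → ℕ
top j r = 3 + j * 4 + toℕ r

record Profile (K : ℕ) (ws : List ℕ) : Set where
  field
    at-0        : incidencesℕ 0 ws ≡ 1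
    at-1        : incidencesℕ 1 ws ≡ 2
    alternating : ∀ {k} → k < K → incidencesℕ k ws ≢ incidencesℕ (suc k) ws
    at-K        : incidencesℕ K ws ≡ 0

ascent-profile : ∀ j r → Profile (top j r) (0 ∷ ascent j r)
ascent-profile zero r = record
  { at-0        = from-yes (all? λ r → incidencesℕ 0 (0 ∷ finish r) ≟ 1) r
  ; at-1        = from-yes (all? λ r → incidencesℕ 1 (0 ∷ finish r) ≟ 2) r
  ; alternating = from-yes (all? λ r → allUpTo? (λ k → ¬? (T r k ≟ T r (suc k))) (3 + toℕ r)) r
  ; at-K        = from-yes (all? λ r → incidencesℕ (3 + toℕ r) (0 ∷ finish r) ≟ 0) r
  }
  where T = λ r k → incidencesℕ k (0 ∷ finish r)
ascent-profile (suc j) r = record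
  { at-0        = low 0 λ _ ()
  ; at-1        = low 1 λ _ ()
  ; alternating = alternating′
  ; at-K        = trans (high (top j r)) (at-K P)
  }
  where
  open Profile
  P = ascent-profile j r
  T Tⱼ B : ℕ → ℕ
  T k  = incidencesℕ k (0 ∷ ascent (suc j) r)
  Tⱼ k = incidencesℕ k (0 ∷ ascent j r)
  B k  = incidencesℕ k (0 ∷ block ++ 4 ∷ [])
  T≡ : ∀ k → T k ≡ B k + incidencesℕ k (map (4 +_) (0 ∷ ascent j r))
  T≡ k = incidencesℕ-++ k (0 ∷ block) 4 (map (4 +_) (ascent j r))
  low : ∀ k → (∀ x → 4 + x ≢ k) → T k ≡ B k
  low k k∉ = trans (T≡ k) (trans (cong (B k +_) (incidencesℕ-map-outside k∉ (0 ∷ ascent j r)))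
                                (+-identityʳ (B k)))
  high : ∀ k → T (4 + k) ≡ B (4 + k) + Tⱼ k
  high k = trans (T≡ (4 + k))
                 (cong (B (4 + k) +_) (incidencesℕ-map-injective (+-cancelˡ-≡ 4 _ _) k (0 ∷ ascent j r)))
  T4 : T 4 ≡ 4
  T4 = trans (high 0) (cong (3 +_) (at-0 P))
  T5 : T 5 ≡ 2
  T5 = trans (high 1) (at-1 P)
  alternating′ : ∀ {k} → k < top (suc j) r → T k ≢ T (suc k)
  alternating′ {0} _ = ≢-via (low 0 λ _ ()) (low 1 λ _ ()) λ ()
  alternating′ {1} _ = ≢-via (low 1 λ _ ()) (low 2 λ _ ()) λ ()
  alternating′ {2} _ = ≢-via (low 2 λ _ ()) (low 3 λ _ ()) λ ()
  alternating′ {3} _ = ≢-via (low 3 λ _ ()) T4 λ ()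
  alternating′ {4} _ = ≢-via T4 T5 λ ()
  alternating′ {suc (suc (suc (suc (suc k))))} (s≤s (s≤s (s≤s (s≤s k+1<K)))) =
    ≢-via (high (suc k)) (high (suc (suc k))) (alternating P k+1<K)

ascent-bounded : ∀ j r → All (_< top j r) (0 ∷ ascent j r)
ascent-bounded zero    r = from-yes (all? λ r → All.all? (_<? 3 + toℕ r) (0 ∷ finish r)) r
ascent-bounded (suc j) r =
  All.++⁺ (All.map (λ v<5 → <-≤-trans v<5 5≤K) (from-yes (All.all? (_<? 5) (0 ∷ block))))
          (All.map⁺ (All.map (+-monoʳ-< 4) (ascent-bounded j r)))
  where 5≤K = s≤s (s≤s (s≤s (s≤s (s≤s z≤n))))

ascent-consecutive : ∀ j r → Linked Consecutive (0 ∷ ascent j r)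
ascent-consecutive zero    r = from-yes (all? λ r → linked? consecutive? (0 ∷ finish r)) r
ascent-consecutive (suc j) r =
  Linked.++⁺ (from-yes (linked? consecutive? (0 ∷ block))) (just (inj₁ refl))
             (Linked.map⁺ (Linked.map (Sum.map (cong (4 +_)) (cong (4 +_))) (ascent-consecutive j r)))

length-ascent : ∀ j r → length (ascent j r) + 4 ≡ 2 * top j r
length-ascent zero    r = from-yes (all? λ r → length (finish r) + 4 ≟ 2 * top 0 r) r
length-ascent (suc j) r = begin
  length (block ++ map (4 +_) (0 ∷ ascent j r)) + 4
    ≡⟨ cong (_+ 4) (length-++ block {map (4 +_) (0 ∷ ascent j r)}) ⟩
  7 + length (map (4 +_) (0 ∷ ascent j r)) + 4
    ≡⟨ cong (λ ℓ → 7 + ℓ + 4) (length-map (4 +_) (0 ∷ ascent j r)) ⟩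
  8 + (length (ascent j r) + 4)
    ≡⟨ cong (8 +_) (length-ascent j r) ⟩
  8 + 2 * top j r
    ≡⟨ *-distribˡ-+ 2 4 (top j r) ⟨
  2 * top (suc j) r
    ∎
  where open ≡-Reasoning

ascent-walk : ∀ {m} j r → m ≡ top j r → IrregularisingWalk (cycle (suc m)) (2 * suc m ∸ 6)
ascent-walk j r refl =
  subst (IrregularisingWalk (cycle n)) length≡ (irregularℕ⇒walk (s≤s (s≤s z≤n)) bounded adjacent irregular)
  where
  open Cycle (top j r)
  open Profile (ascent-profile j r)
  bounded : All (_< n) (0 ∷ ascent j r)
  bounded = All.map m<n⇒m<1+n (ascent-bounded j r)
  adjacent : Linked Adjacent (0 ∷ ascent j r)
  adjacent = Linked-consecutive⇒adjacent bounded (ascent-consecutive j r)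
  irregular : Irregularℕ (0 ∷ ascent j r)
  irregular = path-alternating⇒irregularℕ {0 ∷ ascent j r} alternating (≢-via at-K at-0 λ ())
  length≡ : length (ascent j r) ≡ 2 * n ∸ 6
  length≡ = begin
    length (ascent j r)          ≡⟨ m+n∸n≡m (length (ascent j r)) 4 ⟨
    length (ascent j r) + 4 ∸ 4  ≡⟨ cong (_∸ 4) (length-ascent j r) ⟩
    2 * top j r ∸ 4              ≡⟨ cong (_∸ 6) (*-suc 2 (top j r)) ⟨
    2 * n ∸ 6                    ∎
    where open ≡-Reasoning

prefixed-walk : ∀ {m} j r → m ≡ suc (top j r) → IrregularisingWalk (cycle (suc m)) (2 * suc m ∸ 6)
prefixed-walk j r refl =
  subst (IrregularisingWalk (cycle n)) length≡ (irregularℕ⇒walk (s≤s (s≤s z≤n)) bounded adjacent irregular)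
  where
  open Cycle (suc (top j r))
  open Profile (ascent-profile j r)
  ws : List ℕ
  ws = 1 ∷ 0 ∷ map suc (0 ∷ ascent j r)
  bounded : All (_< n) ws
  bounded = s≤s (s≤s z≤n) ∷ s≤s z≤n ∷ All.map⁺ (All.map (s≤s ∘ m<n⇒m<1+n) (ascent-bounded j r))
  adjacent : Linked Adjacent ws
  adjacent = Linked-consecutive⇒adjacent bounded
    (inj₂ refl ∷ inj₁ refl ∷ Linked.map⁺ (Linked.map (Sum.map (cong suc) (cong suc)) (ascent-consecutive j r)))
  T : ℕ → ℕ
  T k = incidencesℕ k ws
  T-shift : ∀ k → T (suc (suc k)) ≡ incidencesℕ (suc k) (0 ∷ ascent j r)
  T-shift k = incidencesℕ-map-injective suc-injective (suc k) (0 ∷ ascent j r)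
  T0 : T 0 ≡ 2
  T0 = cong (2 +_) (incidencesℕ-map-outside (λ _ ()) (0 ∷ ascent j r))
  T1 : T 1 ≡ 3
  T1 = cong (2 +_) (trans (incidencesℕ-map-injective suc-injective 0 (0 ∷ ascent j r)) at-0)
  alternating′ : ∀ {k} → k < suc (top j r) → T k ≢ T (suc k)
  alternating′ {0}           _             = ≢-via T0 T1 λ ()
  alternating′ {1}           _             = ≢-via T1 (trans (T-shift 0) at-1) λ ()
  alternating′ {suc (suc k)} (s≤s k+1<top) = ≢-via (T-shift k) (T-shift (suc k)) (alternating k+1<top)
  irregular : Irregularℕ ws
  irregular = path-alternating⇒irregularℕ {ws} alternating′ (≢-via (trans (T-shift _) at-K) T0 λ ())
  length≡ : 2 + length (map suc (ascent j r)) ≡ 2 * n ∸ 6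
  length≡ = begin
    2 + length (map suc (ascent j r))  ≡⟨ cong (2 +_) (length-map suc (ascent j r)) ⟩
    2 + length (ascent j r)            ≡⟨ +-comm 2 (length (ascent j r)) ⟩
    length (ascent j r) + 2            ≡⟨ +-∸-assoc (length (ascent j r)) {4} {2} (s≤s (s≤s z≤n)) ⟨
    length (ascent j r) + 4 ∸ 2        ≡⟨ cong (_∸ 2) (length-ascent j r) ⟩
    2 * top j r ∸ 2                    ≡⟨ cong (_∸ 6) (*-distribˡ-+ 2 2 (top j r)) ⟨
    2 * n ∸ 6                          ∎
    where open ≡-Reasoning

residue-mod-4 : ∀ k → (Σ ℕ λ j → Σ (Fin 3) λ r → k ≡ j * 4 + toℕ r) ⊎ (Σ ℕ λ j → k ≡ j * 4 + 3)
residue-mod-4 k = split (k % 4 <? 3)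
  where
  k≡ : k ≡ k / 4 * 4 + k % 4
  k≡ = trans (m≡m%n+[m/n]*n k 4) (+-comm (k % 4) (k / 4 * 4))
  split : Dec (k % 4 < 3) → (Σ ℕ λ j → Σ (Fin 3) λ r → k ≡ j * 4 + toℕ r) ⊎ (Σ ℕ λ j → k ≡ j * 4 + 3)
  split (yes r<3) = inj₁ (k / 4 , fromℕ< r<3 , trans k≡ (cong (k / 4 * 4 +_) (sym (toℕ-fromℕ< r<3))))
  split (no r≮3)  = inj₂ (k / 4 , trans k≡ (cong (k / 4 * 4 +_) (≤-antisym (≤-pred (m%n<n k 4)) (≮⇒≥ r≮3))))

upper-bound : ∀ m → 3 ≤ m → IrregularisingWalk (cycle (suc m)) (2 * suc m ∸ 6)
upper-bound m m≥3 with residue-mod-4 (m ∸ 3)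
... | inj₁ (j , r , m∸3≡) = ascent-walk j r (trans (sym (m+[n∸m]≡n m≥3)) (cong (3 +_) m∸3≡))
... | inj₂ (j , m∸3≡)     =
  prefixed-walk j (# 2) (trans (sym (m+[n∸m]≡n m≥3)) (cong (3 +_) (trans m∸3≡ (+-suc (j * 4) 2))))

-- The triangle

IrregularisingVertices : ∀ {n} → Graph n → List (Fin n) → Set
IrregularisingVertices G ws = ∀ u v → Adj G u v → degree G u + incidences u ws ≢ degree G v + incidences v ws

irregularisingVertices? : ∀ {n} (G : Graph n) ws → Dec (IrregularisingVertices G ws)
irregularisingVertices? G ws = all? λ u → all? λ v →
  adj? G u v →-dec ¬? (degree G u + incidences u ws ≟ degree G v + incidences v ws)

walk⇒¬irregularising? : ∀ {n} (G : Graph n) ws → Dec (Linked (Adj G) ws → ¬ IrregularisingVertices G ws)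
walk⇒¬irregularising? G ws = linked? (adj? G) ws →-dec ¬? (irregularisingVertices? G ws)

triangle-upper : IrregularisingWalk (cycle 3) 3
triangle-upper = walk (# 0) (# 1 ∷ # 2 ∷ # 1 ∷ []) (from-yes (linked? (adj? (cycle 3)) ws))
               , from-yes (irregularisingVertices? (cycle 3) ws)
               , refl
  where ws = # 0 ∷ # 1 ∷ # 2 ∷ # 1 ∷ []

triangle-lower : (W : Walk (cycle 3)) → Irregularising (cycle 3) W → 3 ≤ walkLength W
triangle-lower (walk a [] a-) =
  ⊥-elim ∘ from-yes (all? λ a → walk⇒¬irregularising? (cycle 3) (a ∷ [])) a a-
triangle-lower (walk a (b ∷ []) a-b) =
  ⊥-elim ∘ from-yes (all? λ a → all? λ b → walk⇒¬irregularising? (cycle 3) (a ∷ b ∷ [])) a b a-b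
triangle-lower (walk a (b ∷ c ∷ []) a-b-c) =
  ⊥-elim ∘ from-yes (all? λ a → all? λ b → all? λ c → walk⇒¬irregularising? (cycle 3) (a ∷ b ∷ c ∷ []))
                    a b c a-b-c
triangle-lower (walk _ (_ ∷ _ ∷ _ ∷ _) _) _ = s≤s (s≤s (s≤s z≤n))

corollary5p6 : MLW≡ (cycle 3) 3
    × (∀ (n : ℕ) .{{_ : NonZero n}} → 4 ≤ n → MLW≡ (cycle n) (2 * n ∸ 6))
corollary5p6 =
  (triangle-upper , triangle-lower) ,
  λ { (suc m) (s≤s m≥3) → upper-bound m m≥3 , Cycle.lower-bound m (≤-trans (n≤1+n 2) m≥3) }
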